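{- Let $G=(V,E)$ be a connected finite undirected simple graph and let $S\subseteq V$. Then $G$ contains an $S$-odd walk if and only if $|S|$ is even or $G$ is non-bipartite. Furthermore, when it exists, an $S$-odd walk using each edge at most four times can be found.
   Context: A closed walk is a sequence $v_0e_1v_1\cdots e_\ell v_\ell$ with $e_i=\{v_{i-1},v_i\}\in E$ and $v_\ell=v_0$; vertices and edges may be repeated. The visit number of a vertex $v$ is the number of indices $i\in\{1,\dots,\ell\}$ with $v_i=v$. An $S$-odd walk is a closed walk in which every vertex of $S$ has odd visit number and every vertex of $V\setminus S$ has even visit number. -}

module Defs where

open import Data.Nat using (ℕ; zero; suc; _+_; _≤_)
open import Data.Nat.Divisibility using (_∣_)
open import Data.Bool using (Bool; true; false; T; if_then_else_; _∨_; _∧_)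
open import Data.Fin using (Fin)
open import Data.Fin.Subset using (Subset; _∈_; _∉_)
open import Data.Fin.Properties using (_≟_)
open import Data.Product using (Σ; Σ-syntax; _×_)
open import Relation.Nullary using (¬_)
open import Relation.Nullary.Decidable using (⌊_⌋)
open import Relation.Binary.PropositionalEquality using (_≡_; _≢_)

Even : ℕ → Set
Even m = 2 ∣ m

Odd : ℕ → Set
Odd m = 2 ∣ suc m

record Graph (n : ℕ) : Set where
  field
    adj    : Fin n → Fin n → Bool
    symm   : ∀ u v → adj u v ≡ adj v u
    irrefl : ∀ v → adj v v ≡ false
open Graph public

data Walk {n : ℕ} (G : Graph n) : Fin n → Fin n → Set where
  []  : ∀ {u} → Walk G u u
  _∷_ : ∀ {u v w} → T (adj G u v) → Walk G v w → Walk G u w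

-- Visit number of x: number of indices i ∈ {1,…,ℓ} with v_i = x.
visits : ∀ {n} {G : Graph n} {u w} → Fin n → Walk G u w → ℕ
visits x [] = 0
visits x (_∷_ {v = v} _ W) = (if ⌊ v ≟ x ⌋ then 1 else 0) + visits x W

edgeUses : ∀ {n} {G : Graph n} {u w} → Fin n → Fin n → Walk G u w → ℕ
edgeUses a b [] = 0
edgeUses a b (_∷_ {u = u} {v = v} _ W) =
  (if (⌊ u ≟ a ⌋ ∧ ⌊ v ≟ b ⌋) ∨ (⌊ u ≟ b ⌋ ∧ ⌊ v ≟ a ⌋) then 1 else 0)
  + edgeUses a b W

Connected : ∀ {n} → Graph n → Set
Connected {n} G = ∀ (u v : Fin n) → Walk G u v

Bipartite : ∀ {n} → Graph n → Set
Bipartite {n} G = Σ[ c ∈ (Fin n → Bool) ] (∀ u v → T (adj G u v) → c u ≢ c v)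

IsSOdd : ∀ {n} (G : Graph n) (S : Subset n) {v : Fin n} → Walk G v v → Set
IsSOdd {n} G S W = ∀ (x : Fin n) → (x ∈ S → Odd (visits x W)) × (x ∉ S → Even (visits x W))

HasSOddWalk : ∀ {n} (G : Graph n) (S : Subset n) → Set
HasSOddWalk {n} G S = Σ[ v ∈ Fin n ] Σ[ W ∈ Walk G v v ] IsSOdd G S W

module Submission where

-- The visit numbers of a closed walk add up to its length, so an S-odd walk has length ≡ |S|
-- (mod 2); closed walks in a bipartite graph are even, which gives one direction.  Conversely,
-- take a closed trail C whose length has the parity of |S|: the empty walk if |S| is even, and
-- otherwise a shortest odd closed walk, which uses no edge twice.  Walk along C, and at each
-- vertex u first run a depth-first search through the vertices not claimed yet, leaving each
-- tree vertex y towards its parent once or three times so that y gets the right parity (the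
-- tree edge is used 2 or 4 times); then cross the next edge of C once or three times so that u
-- gets the right parity.  Every vertex but the base of C is finished this way, and the parity of
-- the total length then forces the base as well.

open import Defs
open import Data.Parity.Base as ℙ using (Parity; 0ℙ; 1ℙ)
import Data.Parity.Properties as ℙ
open import Algebra.Properties.CommutativeMonoid.Sum ℙ.+-0-commutativeMonoid
  using (sum; sum-remove; sum-cong-≗; sum-replicate-zero; ∑-distrib-+)
open import Data.Nat.Base using (ℕ; zero; suc; _+_; _*_; _≤_; _<_; z≤n; s≤s; z<s; parity)
open import Data.Nat.Divisibility using (divides)
open import Data.Nat.Properties
  using (+-assoc; +-identityʳ; +-comm; +-suc; +-mono-≤; +-monoʳ-≤; *-monoʳ-≤; ≤-trans; ≤-refl; ≤-pred; ≰⇒>;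
         <-≤-trans; m≤m+n; m≤n+m; n≤1+n; m<m+n; m<n+m; _≤?_; module ≤-Reasoning)
open import Data.Nat.Tactic.RingSolver using (solve-∀)
open import Data.Bool.Base using (Bool; true; false; T; if_then_else_; _∧_; _∨_)
open import Data.Bool.Properties using (∨-comm)
open import Data.Fin.Base using (Fin; zero; suc; punchIn)
open import Data.Fin.Properties using (_≟_; any?; punchInᵢ≢i)
open import Data.Fin.Subset using (Subset; _∈_; _∉_; _⊆_; _⊃_; ⁅_⁆; _∪_; ∣_∣)
open import Data.Fin.Subset.Properties using (_∈?_; x∈⁅x⁆; x∈⁅y⁆⇒x≡y; x∈p∪q⁻; x∈p∪q⁺)
open import Data.Fin.Subset.Induction using (Acc; acc; ⊃-wellFounded)
open import Data.Vec.Base using ([]; _∷_; lookup)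
open import Data.Vec.Functional using (replicate)
open import Data.Vec.Properties using ([]=⇒lookup; lookup⇒[]=)
open import Data.Product.Base using (Σ; Σ-syntax; _×_; _,_; proj₁; proj₂; uncurry)
open import Data.Sum.Base using (_⊎_; inj₁; inj₂; [_,_]′)
import Data.Sum.Base as Sum
open import Function.Base using (_∘_)
open import Function.Bundles using (_⇔_; mk⇔)
open import Relation.Binary.PropositionalEquality
open import Relation.Nullary using (¬_; Dec; yes; no; does; contradiction)
open import Relation.Nullary.Decidable
  using (_×-dec_; _⊎-dec_; ¬?; T?; dec-true; dec-false; ⌊_⌋; isYes≗does; decidable-stable)

parity-suc : ∀ n → parity (suc n) ≡ 1ℙ ℙ.+ parity n
parity-suc = ℙ.+-homo-+ 1

parity-even : ∀ {n} → Even n → parity n ≡ 0ℙ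
parity-even (divides q refl) = trans (ℙ.*-homo-* q 2) (ℙ.*-zeroʳ (parity q))

parity-odd : ∀ {n} → Odd n → parity n ≡ 1ℙ
parity-odd {n} odd = trans (sym (ℙ.suc-homo-⁻¹ n)) (cong ℙ._⁻¹ (parity-even odd))

even-parity : ∀ n → parity n ≡ 0ℙ → Even n
even-parity zero          _ = divides 0 refl
even-parity (suc (suc n)) p with divides q eq ← even-parity n p =
  divides (suc q) (cong (λ k → suc (suc k)) eq)

odd-parity : ∀ n → parity n ≡ 1ℙ → Odd n
odd-parity n p = even-parity (suc n) (trans (parity-suc n) (cong (1ℙ ℙ.+_) p))

sum-concentrated : ∀ {k} (f : Fin k → Parity) i → (∀ j → j ≢ i → f j ≡ 0ℙ) → sum f ≡ f i
sum-concentrated {suc k} f i off = begin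
  sum f                                 ≡⟨ sum-remove {i = i} f ⟩
  f i ℙ.+ sum (λ j → f (punchIn i j))   ≡⟨ cong (f i ℙ.+_) (sum-cong-≗ (λ j → off _ (punchInᵢ≢i i j))) ⟩
  f i ℙ.+ sum (replicate k 0ℙ)          ≡⟨ cong (f i ℙ.+_) (sum-replicate-zero k) ⟩
  f i ℙ.+ 0ℙ                            ≡⟨ ℙ.+-identityʳ (f i) ⟩
  f i                                   ∎
  where open ≡-Reasoning

sum-determines-value : ∀ {k} (f g : Fin k → Parity) i →
  sum f ≡ sum g → (∀ j → j ≢ i → f j ≡ g j) → f i ≡ g i
sum-determines-value {suc k} f g i ∑f≡∑g agree = ℙ.+-cancelʳ-≡ _ (f i) (g i) (begin
  f i ℙ.+ sum (λ j → f (punchIn i j))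
    ≡⟨ sym (sum-remove {i = i} f) ⟩
  sum f
    ≡⟨ ∑f≡∑g ⟩
  sum g
    ≡⟨ sum-remove {i = i} g ⟩
  g i ℙ.+ sum (λ j → g (punchIn i j))
    ≡⟨ cong (g i ℙ.+_) (sum-cong-≗ (λ j → sym (agree _ (punchInᵢ≢i i j)))) ⟩
  g i ℙ.+ sum (λ j → f (punchIn i j)) ∎)
  where open ≡-Reasoning

toParity : Bool → Parity
toParity false = 0ℙ
toParity true  = 1ℙ

χ : ∀ {k} → Subset k → Fin k → Parity
χ S v = toParity (lookup S v)

parity-size : ∀ {k} (S : Subset k) → parity ∣ S ∣ ≡ sum (χ S)
parity-size []          = refl
parity-size (false ∷ S) = parity-size S
parity-size (true ∷ S)  = trans (parity-suc ∣ S ∣) (cong (1ℙ ℙ.+_) (parity-size S))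

Joins : ∀ {m} → Fin m → Fin m → Fin m → Fin m → Set
Joins a b u v = (u ≡ a × v ≡ b) ⊎ (u ≡ b × v ≡ a)

joins-sym : ∀ {m} {a b u v : Fin m} → Joins a b u v → Joins a b v u
joins-sym (inj₁ (u≡a , v≡b)) = inj₂ (v≡b , u≡a)
joins-sym (inj₂ (u≡b , v≡a)) = inj₁ (v≡a , u≡b)

joins? : ∀ {m} (a b u v : Fin m) → Dec (Joins a b u v)
joins? a b u v = (u ≟ a ×-dec v ≟ b) ⊎-dec (u ≟ b ×-dec v ≟ a)

-- The test by which edgeUses counts a step from u to v.
joinsᵇ : ∀ {m} (a b u v : Fin m) → Bool
joinsᵇ a b u v = (⌊ u ≟ a ⌋ ∧ ⌊ v ≟ b ⌋) ∨ (⌊ u ≟ b ⌋ ∧ ⌊ v ≟ a ⌋)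

joinsᵇ≡does : ∀ {m} (a b u v : Fin m) → joinsᵇ a b u v ≡ does (joins? a b u v)
joinsᵇ≡does a b u v =
  cong₂ _∨_ (cong₂ _∧_ (isYes≗does (u ≟ a)) (isYes≗does (v ≟ b)))
            (cong₂ _∧_ (isYes≗does (u ≟ b)) (isYes≗does (v ≟ a)))

isYes-true : ∀ {A : Set} (d : Dec A) → A → ⌊ d ⌋ ≡ true
isYes-true d a = trans (isYes≗does d) (dec-true d a)

isYes-false : ∀ {A : Set} (d : Dec A) → ¬ A → ⌊ d ⌋ ≡ false
isYes-false d ¬a = trans (isYes≗does d) (dec-false d ¬a)

module Walks {m : ℕ} (G : Graph m) where

  private variable
    a b u v w x : Fin m

  infixr 5 _++_
  _++_ : Walk G u v → Walk G v w → Walk G u w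
  []      ++ B = B
  (e ∷ A) ++ B = e ∷ (A ++ B)

  length : Walk G u w → ℕ
  length []      = 0
  length (_ ∷ W) = suc (length W)

  adj-sym : T (adj G u v) → T (adj G v u)
  adj-sym {u} {v} = subst T (symm G u v)

  reverse : Walk G u w → Walk G w u
  reverse []      = []
  reverse (e ∷ W) = reverse W ++ (adj-sym e ∷ [])

  vertices : Walk G u w → Subset m
  vertices {u} []      = ⁅ u ⁆
  vertices {u} (_ ∷ W) = ⁅ u ⁆ ∪ vertices W

  length-++ : (A : Walk G u v) (B : Walk G v w) → length (A ++ B) ≡ length A + length B
  length-++ []      B = refl
  length-++ (e ∷ A) B = cong suc (length-++ A B)

  length-reverse : (W : Walk G u w) → length (reverse W) ≡ length W
  length-reverse []      = refl
  length-reverse (e ∷ W) = begin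
    length (reverse W ++ (adj-sym e ∷ [])) ≡⟨ length-++ (reverse W) _ ⟩
    length (reverse W) + 1                  ≡⟨ +-comm (length (reverse W)) 1 ⟩
    suc (length (reverse W))                ≡⟨ cong suc (length-reverse W) ⟩
    suc (length W)                          ∎
    where open ≡-Reasoning

  visits-++ : ∀ x (A : Walk G u v) (B : Walk G v w) → visits x (A ++ B) ≡ visits x A + visits x B
  visits-++ x []                    B = refl
  visits-++ x (_∷_ {v = v} e A) B =
    trans (cong (_ +_) (visits-++ x A B)) (sym (+-assoc (if ⌊ v ≟ x ⌋ then 1 else 0) _ _))

  edgeUses-++ : ∀ a b (A : Walk G u v) (B : Walk G v w) →
    edgeUses a b (A ++ B) ≡ edgeUses a b A + edgeUses a b B
  edgeUses-++ a b []                        B = refl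
  edgeUses-++ a b (_∷_ {u = u} {v = v} e A) B =
    trans (cong (_ +_) (edgeUses-++ a b A B)) (sym (+-assoc (if joinsᵇ a b u v then 1 else 0) _ _))

  visits-∷-here : (e : T (adj G u v)) (W : Walk G v w) → visits v (e ∷ W) ≡ suc (visits v W)
  visits-∷-here {v = v} e W = cong (λ d → (if d then 1 else 0) + visits v W) (isYes-true (v ≟ v) refl)

  visits-∷-there : v ≢ x → (e : T (adj G u v)) (W : Walk G v w) → visits x (e ∷ W) ≡ visits x W
  visits-∷-there {v = v} {x} v≢x e W = cong (λ d → (if d then 1 else 0) + visits x W) (isYes-false (v ≟ x) v≢x)

  edgeUses-∷-joins : Joins a b u v → (e : T (adj G u v)) (W : Walk G v w) →
    edgeUses a b (e ∷ W) ≡ suc (edgeUses a b W)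
  edgeUses-∷-joins {a} {b} {u} {v} j e W =
    cong (λ d → (if d then 1 else 0) + edgeUses a b W) (trans (joinsᵇ≡does a b u v) (dec-true (joins? a b u v) j))

  edgeUses-∷-apart : ¬ Joins a b u v → (e : T (adj G u v)) (W : Walk G v w) →
    edgeUses a b (e ∷ W) ≡ edgeUses a b W
  edgeUses-∷-apart {a} {b} {u} {v} ¬j e W =
    cong (λ d → (if d then 1 else 0) + edgeUses a b W) (trans (joinsᵇ≡does a b u v) (dec-false (joins? a b u v) ¬j))

  edgeUses-comm : ∀ a b (W : Walk G u w) → edgeUses a b W ≡ edgeUses b a W
  edgeUses-comm a b []                        = refl
  edgeUses-comm a b (_∷_ {u = u} {v = v} e W) =
    cong₂ (λ d n → (if d then 1 else 0) + n) (∨-comm (⌊ u ≟ a ⌋ ∧ ⌊ v ≟ b ⌋) _) (edgeUses-comm a b W)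

  adj⇒≢ : T (adj G u v) → u ≢ v
  adj⇒≢ {u} e refl = subst T (irrefl G u) e

  edgeUses-loop : ∀ a (W : Walk G u w) → edgeUses a a W ≡ 0
  edgeUses-loop a []      = refl
  edgeUses-loop a (e ∷ W) = trans (edgeUses-∷-apart (loopless e) e W) (edgeUses-loop a W)
    where
    loopless : T (adj G u v) → ¬ Joins a a u v
    loopless e (inj₁ (refl , refl)) = adj⇒≢ e refl
    loopless e (inj₂ (refl , refl)) = adj⇒≢ e refl

  edgeUses≤length : ∀ a b (W : Walk G u w) → edgeUses a b W ≤ length W
  edgeUses≤length a b []                        = z≤n
  edgeUses≤length a b (_∷_ {u = u} {v = v} e W) =
    +-mono-≤ (indicator≤1 (joinsᵇ a b u v)) (edgeUses≤length a b W)
    where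
    indicator≤1 : ∀ d → (if d then 1 else 0) ≤ 1
    indicator≤1 true  = s≤s z≤n
    indicator≤1 false = z≤n

  start∈vertices : (W : Walk G u w) → u ∈ vertices W
  start∈vertices {u} []      = x∈⁅x⁆ u
  start∈vertices {u} (_ ∷ W) = x∈p∪q⁺ (inj₁ (x∈⁅x⁆ u))

  vertices-tail : (e : T (adj G u v)) (W : Walk G v w) → vertices W ⊆ vertices (e ∷ W)
  vertices-tail e W = x∈p∪q⁺ ∘ inj₂

  ∈vertices-∷⁻ : (e : T (adj G u v)) (W : Walk G v w) → x ∈ vertices (e ∷ W) → x ≡ u ⊎ x ∈ vertices W
  ∈vertices-∷⁻ {u} e W x∈ = Sum.map₁ (x∈⁅y⁆⇒x≡y u) (x∈p∪q⁻ ⁅ u ⁆ (vertices W) x∈)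

  ∈vertices-++⁻ : (A : Walk G u v) (B : Walk G v w) → x ∈ vertices (A ++ B) → x ∈ vertices A ⊎ x ∈ vertices B
  ∈vertices-++⁻ []      B x∈ = inj₂ x∈
  ∈vertices-++⁻ (e ∷ A) B x∈ with ∈vertices-∷⁻ e (A ++ B) x∈
  ... | inj₁ refl = inj₁ (start∈vertices (e ∷ A))
  ... | inj₂ x∈AB = Sum.map₁ (vertices-tail e A) (∈vertices-++⁻ A B x∈AB)

  ∉vertices⇒visits≡0 : (W : Walk G u w) → x ∉ vertices W → visits x W ≡ 0
  ∉vertices⇒visits≡0 []      _  = refl
  ∉vertices⇒visits≡0 (e ∷ W) x∉ =
    trans (visits-∷-there (λ { refl → x∉ (vertices-tail e W (start∈vertices W)) }) e W)
          (∉vertices⇒visits≡0 W (x∉ ∘ vertices-tail e W))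

  ∉vertices⇒edgeUses≡0 : (W : Walk G u w) → a ∉ vertices W → edgeUses a b W ≡ 0
  ∉vertices⇒edgeUses≡0                   []      _  = refl
  ∉vertices⇒edgeUses≡0 {a = a} {b} (_∷_ {u = u} {v = v} e W) a∉ =
    trans (edgeUses-∷-apart endpoint-outside e W) (∉vertices⇒edgeUses≡0 W (a∉ ∘ vertices-tail e W))
    where
    endpoint-outside : ¬ Joins a b u v
    endpoint-outside (inj₁ (refl , _)) = a∉ (start∈vertices (e ∷ W))
    endpoint-outside (inj₂ (_ , refl)) = a∉ (vertices-tail e W (start∈vertices W))

  edgeUses-inside≡0 : ∀ {U : Subset m} (W : Walk G u w) → (∀ {y} → y ∈ vertices W → y ∈ U → y ≡ x) →
    a ∈ U → b ∈ U → edgeUses a b W ≡ 0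
  edgeUses-inside≡0 {a = a} {b} W meets a∈U b∈U with a ∈? vertices W | b ∈? vertices W
  ... | no a∉  | _      = ∉vertices⇒edgeUses≡0 W a∉
  ... | yes _  | no b∉  = trans (edgeUses-comm a b W) (∉vertices⇒edgeUses≡0 W b∉)
  ... | yes a∈ | yes b∈ with refl ← meets a∈ a∈U | refl ← meets b∈ b∈U = edgeUses-loop a W

  edgeUses-disjoint : ∀ {s t} (A : Walk G u v) (B : Walk G s t) →
    (∀ {y} → y ∈ vertices A → y ∈ vertices B → y ≡ x) →
    ∀ a b → edgeUses a b A ≡ 0 ⊎ edgeUses a b B ≡ 0
  edgeUses-disjoint A B meets a b with a ∈? vertices A | b ∈? vertices A
  ... | no a∉  | _      = inj₁ (∉vertices⇒edgeUses≡0 A a∉)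
  ... | yes _  | no b∉  = inj₁ (trans (edgeUses-comm a b A) (∉vertices⇒edgeUses≡0 A b∉))
  ... | yes a∈ | yes b∈ = inj₂ (edgeUses-inside≡0 B (λ y∈B y∈A → meets y∈A y∈B) a∈ b∈)

  edgeUses-++-≤ : ∀ {k} (A : Walk G u v) (B : Walk G v w) → edgeUses a b A ≡ 0 ⊎ edgeUses a b B ≡ 0 →
    edgeUses a b A ≤ k → edgeUses a b B ≤ k → edgeUses a b (A ++ B) ≤ k
  edgeUses-++-≤ {a = a} {b} A B (inj₁ A≡0) _ B≤k =
    subst (_≤ _) (sym (trans (edgeUses-++ a b A B) (cong (_+ _) A≡0))) B≤k
  edgeUses-++-≤ {a = a} {b} A B (inj₂ B≡0) A≤k _ =
    subst (_≤ _) (sym (trans (edgeUses-++ a b A B) (trans (cong (_ +_) B≡0) (+-identityʳ _)))) A≤k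

  parity-length : (W : Walk G u w) → parity (length W) ≡ sum (λ x → parity (visits x W))
  parity-length []                    = sym (sum-replicate-zero m)
  parity-length (_∷_ {v = v} e W) = begin
    parity (suc (length W))
      ≡⟨ parity-suc (length W) ⟩
    1ℙ ℙ.+ parity (length W)
      ≡⟨ cong₂ ℙ._+_ (sym ∑step≡1ℙ) (parity-length W) ⟩
    sum step ℙ.+ sum (λ x → parity (visits x W))
      ≡⟨ sym (∑-distrib-+ step _) ⟩
    sum (λ x → step x ℙ.+ parity (visits x W))
      ≡⟨ sum-cong-≗ (λ x → sym (ℙ.+-homo-+ (if ⌊ v ≟ x ⌋ then 1 else 0) (visits x W))) ⟩
    sum (λ x → parity (visits x (e ∷ W))) ∎
    where
    open ≡-Reasoning
    step : Fin m → Parity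
    step x = parity (if ⌊ v ≟ x ⌋ then 1 else 0)
    ∑step≡1ℙ : sum step ≡ 1ℙ
    ∑step≡1ℙ = trans (sum-concentrated step v off) (cong (λ d → parity (if d then 1 else 0)) (isYes-true (v ≟ v) refl))
      where
      off : ∀ x → x ≢ v → step x ≡ 0ℙ
      off x x≢v = cong (λ d → parity (if d then 1 else 0)) (isYes-false (v ≟ x) (x≢v ∘ sym))

-- Parity of the length and bipartiteness

module _ {m : ℕ} {S : Subset m} {x : Fin m} where

  χ-∈ : x ∈ S → χ S x ≡ 1ℙ
  χ-∈ x∈S = cong toParity ([]=⇒lookup x∈S)

  χ-∉ : x ∉ S → χ S x ≡ 0ℙ
  χ-∉ x∉S with lookup S x in eq
  ... | false = refl
  ... | true  = contradiction (lookup⇒[]= x S eq) x∉S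

module _ {m : ℕ} {G : Graph m} where

  open Walks G

  private variable
    u v w : Fin m

  isSOdd⇒parity : ∀ {S} (W : Walk G v v) → IsSOdd G S W → ∀ x → parity (visits x W) ≡ χ S x
  isSOdd⇒parity {S = S} W odd x with x ∈? S
  ... | yes x∈S = trans (parity-odd  (proj₁ (odd x) x∈S)) (sym (χ-∈ x∈S))
  ... | no  x∉S = trans (parity-even (proj₂ (odd x) x∉S)) (sym (χ-∉ x∉S))

  parity⇒isSOdd : ∀ {S} (W : Walk G v v) → (∀ x → parity (visits x W) ≡ χ S x) → IsSOdd G S W
  parity⇒isSOdd W p x = (λ x∈S → odd-parity  _ (trans (p x) (χ-∈ x∈S)))
                      , (λ x∉S → even-parity _ (trans (p x) (χ-∉ x∉S)))

  parity-size≡parity-length : ∀ {S} (W : Walk G v v) → IsSOdd G S W → parity ∣ S ∣ ≡ parity (length W)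
  parity-size≡parity-length {S = S} W odd = begin
    parity ∣ S ∣                        ≡⟨ parity-size S ⟩
    sum (χ S)                           ≡⟨ sum-cong-≗ (sym ∘ isSOdd⇒parity W odd) ⟩
    sum (λ x → parity (visits x W))     ≡⟨ sym (parity-length W) ⟩
    parity (length W)                   ∎
    where open ≡-Reasoning

  colour-parity : (c : Fin m → Bool) → (∀ u v → T (adj G u v) → c u ≢ c v) →
    (W : Walk G u w) → toParity (c u) ℙ.+ toParity (c w) ≡ parity (length W)
  colour-parity {u} c proper []                    = ℙ.p+p≡0ℙ (toParity (c u))
  colour-parity {w = w} c proper (_∷_ {u = u} {v = v} e W) = begin
    toParity (c u) ℙ.+ toParity (c w)
      ≡⟨ telescope (toParity (c u)) (toParity (c v)) _ ⟩
    (toParity (c u) ℙ.+ toParity (c v)) ℙ.+ (toParity (c v) ℙ.+ toParity (c w))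
      ≡⟨ cong₂ ℙ._+_ (flip (proper u v e)) (colour-parity c proper W) ⟩
    1ℙ ℙ.+ parity (length W)
      ≡⟨ sym (parity-suc (length W)) ⟩
    parity (length (e ∷ W)) ∎
    where
    open ≡-Reasoning
    telescope : ∀ p q r → p ℙ.+ r ≡ (p ℙ.+ q) ℙ.+ (q ℙ.+ r)
    telescope 0ℙ 0ℙ r = refl
    telescope 0ℙ 1ℙ r = sym (ℙ.⁻¹-involutive r)
    telescope 1ℙ 0ℙ r = refl
    telescope 1ℙ 1ℙ r = refl
    flip : ∀ {a b} → a ≢ b → toParity a ℙ.+ toParity b ≡ 1ℙ
    flip {false} {false} a≢b = contradiction refl a≢b
    flip {false} {true}  _   = refl
    flip {true}  {false} _   = refl
    flip {true}  {true}  a≢b = contradiction refl a≢b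

  bipartite⇒even-closed-walks : Bipartite G → (W : Walk G v v) → parity (length W) ≡ 0ℙ
  bipartite⇒even-closed-walks {v} (c , proper) W = trans (sym (colour-parity c proper W)) (ℙ.p+p≡0ℙ (toParity (c v)))

  sOddWalk⇒even∨nonBipartite : ∀ {S} → HasSOddWalk G S → Even ∣ S ∣ ⊎ ¬ Bipartite G
  sOddWalk⇒even∨nonBipartite {S} (v , W , odd) with parity ∣ S ∣ in eq
  ... | 0ℙ = inj₁ (even-parity _ eq)
  ... | 1ℙ = inj₂ λ bipartite →
    contradiction (trans (sym eq) (trans (parity-size≡parity-length W odd) (bipartite⇒even-closed-walks bipartite W))) λ ()

  closed⇒everything : Connected G → ∀ {K : Subset m} {r} → r ∈ K →
    (∀ {v} → v ∈ K → ∀ w → T (adj G v w) → w ∈ K) → ∀ v → v ∈ K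
  closed⇒everything conn {K} {r} r∈K closed v = along (conn r v) r∈K
    where
    along : ∀ {u w} → Walk G u w → u ∈ K → w ∈ K
    along []                u∈K = u∈K
    along (_∷_ {v = v} e W) u∈K = along W (closed u∈K v e)

  private
    side : Connected G → Fin m → Fin m → Parity
    side conn r x = parity (length (conn r x))

  oddClosedWalk : Connected G → ¬ Bipartite G → (r : Fin m) → Σ[ W ∈ Walk G r r ] parity (length W) ≡ 1ℙ
  oddClosedWalk conn ¬bipartite r
    with any? (λ u → any? (λ v → T? (adj G u v) ×-dec (side conn r u ℙ.≟ side conn r v)))
  ... | yes (u , v , e , same-side) = conn r u ++ (e ∷ reverse (conn r v)) , odd
    where
    open ≡-Reasoning
    odd : parity (length (conn r u ++ (e ∷ reverse (conn r v)))) ≡ 1ℙ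
    odd = begin
      parity (length (conn r u ++ (e ∷ reverse (conn r v))))
        ≡⟨ cong parity (length-++ (conn r u) _) ⟩
      parity (length (conn r u) + suc (length (reverse (conn r v))))
        ≡⟨ ℙ.+-homo-+ (length (conn r u)) _ ⟩
      side conn r u ℙ.+ parity (suc (length (reverse (conn r v))))
        ≡⟨ cong₂ ℙ._+_ same-side (parity-suc (length (reverse (conn r v)))) ⟩
      side conn r v ℙ.+ (1ℙ ℙ.+ parity (length (reverse (conn r v))))
        ≡⟨ cong (λ n → side conn r v ℙ.+ (1ℙ ℙ.+ parity n)) (length-reverse (conn r v)) ⟩
      side conn r v ℙ.+ (1ℙ ℙ.+ side conn r v)
        ≡⟨ p+1+p (side conn r v) ⟩
      1ℙ ∎
      where p+1+p : ∀ p → p ℙ.+ (1ℙ ℙ.+ p) ≡ 1ℙ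
            p+1+p 0ℙ = refl
            p+1+p 1ℙ = refl
  ... | no no-monochromatic-edge = contradiction (isOdd ∘ side conn r , proper) ¬bipartite
    where
    isOdd : Parity → Bool
    isOdd 0ℙ = false
    isOdd 1ℙ = true
    isOdd-injective : ∀ p q → isOdd p ≡ isOdd q → p ≡ q
    isOdd-injective 0ℙ 0ℙ _ = refl
    isOdd-injective 1ℙ 1ℙ _ = refl
    proper : ∀ u v → T (adj G u v) → isOdd (side conn r u) ≢ isOdd (side conn r v)
    proper u v e same = no-monochromatic-edge (u , v , e , isOdd-injective _ _ same)

-- Odd closed trails

ShorterPair : ℕ → ℕ → ℕ → Set
ShorterPair l r n = l < n × r < n × parity l ℙ.+ parity r ≡ parity n

shorterPair-+ : ∀ l r → 0 < l → 0 < r → ShorterPair l r (l + r)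
shorterPair-+ l r 0<l 0<r = m<m+n l 0<r , m<n+m r 0<l , sym (ℙ.+-homo-+ l r)

shorterPair-2+ : ∀ l r → ShorterPair l r (2 + (l + r))
shorterPair-2+ l r = s≤s (≤-trans (m≤m+n l r) (n≤1+n _))
                   , s≤s (≤-trans (m≤n+m r l) (n≤1+n _))
                   , sym (ℙ.+-homo-+ l r)

module _ {m : ℕ} {G : Graph m} where

  open Walks G

  private variable
    a b u w : Fin m

  Trail : Walk G u w → Set
  Trail W = ∀ a b → edgeUses a b W ≤ 1

  record FirstUse (a b : Fin m) (W : Walk G u w) : Set where
    field
      {p q}   : Fin m
      before  : Walk G u p
      edge    : T (adj G p q)
      after   : Walk G q w
      joins   : Joins a b p q
      length≡ : length before + suc (length after) ≡ length W
      uses≡   : edgeUses a b W ≡ suc (edgeUses a b after)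

  firstUse : (W : Walk G u w) → edgeUses a b W ≢ 0 → FirstUse a b W
  firstUse []                                  unused = contradiction refl unused
  firstUse {a = a} {b} (_∷_ {u = u} {v = v} e W) used with joins? a b u v
  ... | yes j  = record { before = [] ; edge = e ; after = W ; joins = j
                        ; length≡ = refl ; uses≡ = edgeUses-∷-joins j e W }
  ... | no  ¬j = record { before = e ∷ before ; edge = edge ; after = after ; joins = joins
                        ; length≡ = cong suc length≡ ; uses≡ = trans (edgeUses-∷-apart ¬j e W) uses≡ }
    where open FirstUse (firstUse W (used ∘ trans (edgeUses-∷-apart ¬j e W)))

  joins-same-edge : ∀ {p q p′ q′} → Joins a b p q → Joins a b p′ q′ →
    (p′ ≡ p × q′ ≡ q) ⊎ (p′ ≡ q × q′ ≡ p)
  joins-same-edge (inj₁ (refl , refl)) (inj₁ (refl , refl)) = inj₁ (refl , refl)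
  joins-same-edge (inj₁ (refl , refl)) (inj₂ (refl , refl)) = inj₂ (refl , refl)
  joins-same-edge (inj₂ (refl , refl)) (inj₁ (refl , refl)) = inj₂ (refl , refl)
  joins-same-edge (inj₂ (refl , refl)) (inj₂ (refl , refl)) = inj₁ (refl , refl)

  record Split (n : ℕ) : Set where
    field
      {s t}   : Fin m
      left    : Walk G s s
      right   : Walk G t t
      shorter : ShorterPair (length left) (length right) n

  -- Two traversals of the edge {p, q} in the same direction leave the closed walks [p q … p]
  -- and [… p q …]; in opposite directions they leave [q … q] and [… p …].
  cut : ∀ {p q p′ q′} (B : Walk G u p) (e : T (adj G p q)) (M : Walk G q p′)
        (e′ : T (adj G p′ q′)) (A : Walk G q′ u) →
    (p′ ≡ p × q′ ≡ q) ⊎ (p′ ≡ q × q′ ≡ p) → Split (length B + suc (length M + suc (length A)))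
  cut B e M e′ A (inj₁ (refl , refl)) = record
    { left = e ∷ M ; right = B ++ (e′ ∷ A)
    ; shorter = subst₂ (ShorterPair (suc (length M))) (sym (length-++ B (e′ ∷ A)))
                  (same (length B) (length M) (length A))
                  (shorterPair-+ (suc (length M)) (length B + suc (length A))
                                 z<s (subst (0 <_) (sym (+-suc (length B) (length A))) z<s)) }
    where
    same : ∀ b m a → suc m + (b + suc a) ≡ b + suc (m + suc a)
    same = solve-∀
  cut B e M e′ A (inj₂ (refl , refl)) = record
    { left = M ; right = B ++ A
    ; shorter = subst₂ (ShorterPair (length M)) (sym (length-++ B A))
                  (opposite (length B) (length M) (length A)) (shorterPair-2+ (length M) (length B + length A)) }
    where
    opposite : ∀ b m a → 2 + (m + (b + a)) ≡ b + suc (m + suc a)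
    opposite = solve-∀

  splitAtRepeatedEdge : (W : Walk G u u) → 2 ≤ edgeUses a b W → Split (length W)
  splitAtRepeatedEdge W 2≤uses = subst Split lengths
    (cut F₁.before F₁.edge F₂.before F₂.edge F₂.after (joins-same-edge F₁.joins F₂.joins))
    where
    F₁ = firstUse W (λ uses≡0 → contradiction (subst (2 ≤_) uses≡0 2≤uses) λ ())
    module F₁ = FirstUse F₁
    F₂ = firstUse F₁.after λ uses≡0 →
      contradiction (subst (2 ≤_) (trans F₁.uses≡ (cong suc uses≡0)) 2≤uses) λ { (s≤s ()) }
    module F₂ = FirstUse F₂
    lengths : length F₁.before + suc (length F₂.before + suc (length F₂.after)) ≡ length W
    lengths = trans (cong (λ n → length F₁.before + suc n) F₂.length≡) F₁.length≡

  ClosedTrail : Parity → Set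
  ClosedTrail p = Σ[ c ∈ Fin m ] Σ[ C ∈ Walk G c c ] Trail C × parity (length C) ≡ p

  shortenToTrail : ∀ k (W : Walk G u u) → length W < k → parity (length W) ≡ 1ℙ → ClosedTrail 1ℙ
  shortenToTrail (suc k) W <k odd with any? (λ a → any? (λ b → 2 ≤? edgeUses a b W))
  ... | no no-repeat = _ , W , (λ a b → ≤-pred (≰⇒> (λ 2≤ → no-repeat (a , b , 2≤)))) , odd
  ... | yes (a , b , 2≤) with splitAtRepeatedEdge W 2≤
  ...   | record { left = L ; right = R ; shorter = L< , R< , parities } with parity (length L) in L-parity
  ...     | 1ℙ = shortenToTrail k L (<-≤-trans L< (≤-pred <k)) L-parity
  ...     | 0ℙ = shortenToTrail k R (<-≤-trans R< (≤-pred <k)) (trans parities odd)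

  oddClosedTrail : Connected G → ¬ Bipartite G → Fin m → ClosedTrail 1ℙ
  oddClosedTrail conn ¬bipartite r with W , odd ← oddClosedWalk conn ¬bipartite r =
    shortenToTrail (suc (length W)) W ≤-refl odd

-- Walks with prescribed visit parities

spend-three : ∀ t k {s} → s ≤ 3 → t + s + 3 * k ≤ t + 3 * suc k
spend-three t k {s} s≤3 = subst (t + s + 3 * k ≤_) (t+3+3k t k) (+-mono-≤ (+-monoʳ-≤ t s≤3) ≤-refl)
  where
  t+3+3k : ∀ t k → t + 3 + 3 * k ≡ t + 3 * suc k
  t+3+3k = solve-∀

module Construction {m : ℕ} (G : Graph m) (τ : Fin m → Parity) where

  open Walks G

  private variable
    a b s u v w x y : Fin m
    R : Subset m

  TargetWalk : Fin m → Set
  TargetWalk c = Σ[ W ∈ Walk G c c ] (∀ x → parity (visits x W) ≡ τ x) × (∀ a b → edgeUses a b W ≤ 4)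

  -- The outcome of a depth-first search from x that may not enter R.
  record Excursion (R : Subset m) (x : Fin m) : Set where
    field
      claimed          : Subset m
      R⊆claimed        : R ⊆ claimed
      walk             : Walk G x x
      vertices⊆claimed : vertices walk ⊆ claimed
      meets-R-at-root  : v ∈ vertices walk → v ∈ R → v ≡ x
      uses≤4           : ∀ a b → edgeUses a b walk ≤ 4
      parity-new       : v ∈ claimed → v ∉ R → parity (visits v walk) ≡ τ v
      even-length      : parity (length walk) ≡ 0ℙ
      closed-new       : v ∈ claimed → v ∉ R → ∀ w → T (adj G v w) → w ∈ claimed

  Saturated : Excursion R x → Set
  Saturated {x = x} F = ∀ w → T (adj G x w) → w ∈ Excursion.claimed F

  stay : x ∈ R → Excursion R x
  stay {x} {R} x∈R = record
    { claimed          = R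
    ; R⊆claimed        = λ v∈R → v∈R
    ; walk             = []
    ; vertices⊆claimed = λ v∈ → subst (_∈ R) (sym (x∈⁅y⁆⇒x≡y x v∈)) x∈R
    ; meets-R-at-root  = λ v∈ _ → x∈⁅y⁆⇒x≡y x v∈
    ; uses≤4           = λ _ _ → z≤n
    ; parity-new       = contradiction
    ; even-length      = refl
    ; closed-new       = contradiction
    }

  module _ (A : Walk G s x) (A⊆R : vertices A ⊆ R) (F : Excursion R x) where
    open Excursion F

    vertices-++-excursion : vertices (A ++ walk) ⊆ claimed
    vertices-++-excursion = [ R⊆claimed ∘ A⊆R , vertices⊆claimed ]′ ∘ ∈vertices-++⁻ A walk

    visits-++-excursion-old : v ∈ R → v ≢ x → visits v (A ++ walk) ≡ visits v A
    visits-++-excursion-old {v} v∈R v≢x = begin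
      visits v (A ++ walk)
        ≡⟨ visits-++ v A walk ⟩
      visits v A + visits v walk
        ≡⟨ cong (visits v A +_) (∉vertices⇒visits≡0 walk (λ v∈ → v≢x (meets-R-at-root v∈ v∈R))) ⟩
      visits v A + 0
        ≡⟨ +-identityʳ _ ⟩
      visits v A ∎
      where open ≡-Reasoning

    parity-++-excursion-new : v ∈ claimed → v ∉ R → parity (visits v (A ++ walk)) ≡ τ v
    parity-++-excursion-new {v} v∈ v∉R = begin
      parity (visits v (A ++ walk))
        ≡⟨ cong parity (visits-++ v A walk) ⟩
      parity (visits v A + visits v walk)
        ≡⟨ cong (λ n → parity (n + visits v walk)) (∉vertices⇒visits≡0 A (v∉R ∘ A⊆R)) ⟩
      parity (visits v walk)
        ≡⟨ parity-new v∈ v∉R ⟩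
      τ v ∎
      where open ≡-Reasoning

    edgeUses-++-excursion≤4 : edgeUses a b A ≤ 4 → edgeUses a b (A ++ walk) ≤ 4
    edgeUses-++-excursion≤4 {a} {b} A≤4 =
      edgeUses-++-≤ A walk (edgeUses-disjoint A walk (λ v∈A v∈W → meets-R-at-root v∈W (A⊆R v∈A)) a b) A≤4 (uses≤4 a b)

    edgeUses-++-excursion-inside : a ∈ R → b ∈ R → edgeUses a b (A ++ walk) ≡ edgeUses a b A
    edgeUses-++-excursion-inside {a} {b} a∈R b∈R = begin
      edgeUses a b (A ++ walk)
        ≡⟨ edgeUses-++ a b A walk ⟩
      edgeUses a b A + edgeUses a b walk
        ≡⟨ cong (edgeUses a b A +_) (edgeUses-inside≡0 walk meets-R-at-root a∈R b∈R) ⟩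
      edgeUses a b A + 0
        ≡⟨ +-identityʳ _ ⟩
      edgeUses a b A ∎
      where open ≡-Reasoning

    parity-length-++-excursion : parity (length (A ++ walk)) ≡ parity (length A)
    parity-length-++-excursion = begin
      parity (length (A ++ walk))                     ≡⟨ cong parity (length-++ A walk) ⟩
      parity (length A + length walk)                 ≡⟨ ℙ.+-homo-+ (length A) (length walk) ⟩
      parity (length A) ℙ.+ parity (length walk)      ≡⟨ cong (parity (length A) ℙ.+_) even-length ⟩
      parity (length A) ℙ.+ 0ℙ                        ≡⟨ ℙ.+-identityʳ _ ⟩
      parity (length A)                               ∎
      where open ≡-Reasoning

  concat : x ∈ R → (F₁ : Excursion R x) → Excursion (Excursion.claimed F₁) x → Excursion R x
  concat {x} {R} x∈R F₁ F₂ = record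
    { claimed          = F₂.claimed
    ; R⊆claimed        = F₂.R⊆claimed ∘ F₁.R⊆claimed
    ; walk             = F₁.walk ++ F₂.walk
    ; vertices⊆claimed = vertices-++-excursion F₁.walk F₁.vertices⊆claimed F₂
    ; meets-R-at-root  = meets-R-at-root
    ; uses≤4           = λ a b → edgeUses-++-excursion≤4 F₁.walk F₁.vertices⊆claimed F₂ (F₁.uses≤4 a b)
    ; parity-new       = parity-new
    ; even-length      = trans (parity-length-++-excursion F₁.walk F₁.vertices⊆claimed F₂) F₁.even-length
    ; closed-new       = closed-new
    }
    where
    module F₁ = Excursion F₁
    module F₂ = Excursion F₂

    meets-R-at-root : v ∈ vertices (F₁.walk ++ F₂.walk) → v ∈ R → v ≡ x
    meets-R-at-root v∈ v∈R with ∈vertices-++⁻ F₁.walk F₂.walk v∈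
    ... | inj₁ v∈₁ = F₁.meets-R-at-root v∈₁ v∈R
    ... | inj₂ v∈₂ = F₂.meets-R-at-root v∈₂ (F₁.R⊆claimed v∈R)

    parity-new : v ∈ F₂.claimed → v ∉ R → parity (visits v (F₁.walk ++ F₂.walk)) ≡ τ v
    parity-new {v} v∈₂ v∉R with v ∈? F₁.claimed
    ... | yes v∈₁ = trans (cong parity (visits-++-excursion-old F₁.walk F₁.vertices⊆claimed F₂ v∈₁ λ { refl → v∉R x∈R }))
                          (F₁.parity-new v∈₁ v∉R)
    ... | no  v∉₁ = parity-++-excursion-new F₁.walk F₁.vertices⊆claimed F₂ v∈₂ v∉₁

    closed-new : v ∈ F₂.claimed → v ∉ R → ∀ w → T (adj G v w) → w ∈ F₂.claimed
    closed-new {v} v∈₂ v∉R w e with v ∈? F₁.claimed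
    ... | yes v∈₁ = F₂.R⊆claimed (F₁.closed-new v∈₁ v∉R w e)
    ... | no  v∉₁ = F₂.closed-new v∈₂ v∉₁ w e

  module _ (e : T (adj G u v)) where

    -- Crossing three times instead of once visits u once more.
    bounce : Parity → Walk G u v
    bounce 0ℙ = e ∷ []
    bounce 1ℙ = e ∷ (adj-sym e ∷ (e ∷ []))

    ∈vertices-bounce⁻ : ∀ β → w ∈ vertices (bounce β) → w ≡ u ⊎ w ≡ v
    ∈vertices-bounce⁻ 0ℙ w∈ = Sum.map (x∈⁅y⁆⇒x≡y u) (x∈⁅y⁆⇒x≡y v) (x∈p∪q⁻ ⁅ u ⁆ ⁅ v ⁆ w∈)
    ∈vertices-bounce⁻ 1ℙ w∈ with ∈vertices-∷⁻ e (adj-sym e ∷ (e ∷ [])) w∈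
    ... | inj₁ w≡u = inj₁ w≡u
    ... | inj₂ w∈′ with ∈vertices-∷⁻ (adj-sym e) (e ∷ []) w∈′
    ...   | inj₁ w≡v  = inj₂ w≡v
    ...   | inj₂ w∈″ = ∈vertices-bounce⁻ 0ℙ w∈″

    parity-visits-bounce-start : ∀ β → parity (visits u (bounce β)) ≡ β
    parity-visits-bounce-start 0ℙ = cong parity (visits-∷-there v≢u e [])
      where v≢u = adj⇒≢ (adj-sym e)
    parity-visits-bounce-start 1ℙ = cong parity
      (trans (visits-∷-there v≢u e (adj-sym e ∷ (e ∷ [])))
      (trans (visits-∷-here (adj-sym e) (e ∷ []))
             (cong suc (visits-∷-there v≢u e []))))
      where v≢u = adj⇒≢ (adj-sym e)

    parity-length-bounce : ∀ β → parity (length (bounce β)) ≡ 1ℙ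
    parity-length-bounce 0ℙ = refl
    parity-length-bounce 1ℙ = refl

    edgeUses-bounce≤3 : ∀ a b β → edgeUses a b (bounce β) ≤ 3
    edgeUses-bounce≤3 a b 0ℙ = ≤-trans (edgeUses≤length a b (bounce 0ℙ)) (s≤s z≤n)
    edgeUses-bounce≤3 a b 1ℙ = edgeUses≤length a b (bounce 1ℙ)

    edgeUses-bounce-apart : ¬ Joins a b u v → ∀ β → edgeUses a b (bounce β) ≡ 0
    edgeUses-bounce-apart ¬j 0ℙ = edgeUses-∷-apart ¬j e []
    edgeUses-bounce-apart ¬j 1ℙ =
      trans (edgeUses-∷-apart ¬j e (adj-sym e ∷ (e ∷ [])))
     (trans (edgeUses-∷-apart (¬j ∘ joins-sym) (adj-sym e) (e ∷ []))
            (edgeUses-∷-apart ¬j e []))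

  module Hang (e : T (adj G x y)) (x∈R : x ∈ R) (y∉R : y ∉ R)
              (F : Excursion (⁅ y ⁆ ∪ R) y) (saturated : Saturated F) where

    module F = Excursion F

    -- y is visited on arrival, inside F, and β times on the way back.
    β : Parity
    β = (1ℙ ℙ.+ parity (visits y F.walk)) ℙ.+ τ y

    back : Walk G y x
    back = bounce (adj-sym e) β

    hung : Walk G x x
    hung = e ∷ (F.walk ++ back)

    R⊆R₁ : R ⊆ ⁅ y ⁆ ∪ R
    R⊆R₁ = x∈p∪q⁺ ∘ inj₂

    ∉R₁ : v ≢ y → v ∉ R → v ∉ ⁅ y ⁆ ∪ R
    ∉R₁ v≢y v∉R v∈R₁ = [ v≢y ∘ x∈⁅y⁆⇒x≡y y , v∉R ]′ (x∈p∪q⁻ ⁅ y ⁆ R v∈R₁)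

    y∈claimed : y ∈ F.claimed
    y∈claimed = F.R⊆claimed (x∈p∪q⁺ (inj₁ (x∈⁅x⁆ y)))

    ∈vertices-hung⁻ : v ∈ vertices hung → v ≡ x ⊎ v ≡ y ⊎ v ∈ vertices F.walk
    ∈vertices-hung⁻ v∈ with ∈vertices-∷⁻ e (F.walk ++ back) v∈
    ... | inj₁ v≡x = inj₁ v≡x
    ... | inj₂ v∈′ with ∈vertices-++⁻ F.walk back v∈′
    ...   | inj₁ v∈W = inj₂ (inj₂ v∈W)
    ...   | inj₂ v∈b = [ inj₂ ∘ inj₁ , inj₁ ]′ (∈vertices-bounce⁻ (adj-sym e) β v∈b)

    vertices⊆claimed : vertices hung ⊆ F.claimed
    vertices⊆claimed v∈ with ∈vertices-hung⁻ v∈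
    ... | inj₁ refl        = F.R⊆claimed (R⊆R₁ x∈R)
    ... | inj₂ (inj₁ refl) = y∈claimed
    ... | inj₂ (inj₂ v∈W)  = F.vertices⊆claimed v∈W

    meets-R-at-root : v ∈ vertices hung → v ∈ R → v ≡ x
    meets-R-at-root v∈ v∈R with ∈vertices-hung⁻ v∈
    ... | inj₁ v≡x         = v≡x
    ... | inj₂ (inj₁ refl) = contradiction v∈R y∉R
    ... | inj₂ (inj₂ v∈W)  with refl ← F.meets-R-at-root v∈W (R⊆R₁ v∈R) = contradiction v∈R y∉R

    uses≤4 : ∀ a b → edgeUses a b hung ≤ 4
    uses≤4 a b with joins? a b x y
    ... | yes j = begin
      edgeUses a b hung
        ≡⟨ edgeUses-∷-joins j e (F.walk ++ back) ⟩
      suc (edgeUses a b (F.walk ++ back))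
        ≡⟨ cong suc (edgeUses-++ a b F.walk back) ⟩
      suc (edgeUses a b F.walk + edgeUses a b back)
        ≡⟨ cong (λ n → suc (n + edgeUses a b back)) (unused-by-F j) ⟩
      suc (edgeUses a b back)
        ≤⟨ s≤s (edgeUses-bounce≤3 (adj-sym e) a b β) ⟩
      4 ∎
      where
      open ≤-Reasoning
      ∈R₁ : v ≡ x ⊎ v ≡ y → v ∈ ⁅ y ⁆ ∪ R
      ∈R₁ (inj₁ refl) = R⊆R₁ x∈R
      ∈R₁ (inj₂ refl) = x∈p∪q⁺ (inj₁ (x∈⁅x⁆ y))
      unused-by-F : Joins a b x y → edgeUses a b F.walk ≡ 0
      unused-by-F (inj₁ (refl , refl)) = edgeUses-inside≡0 F.walk F.meets-R-at-root (∈R₁ (inj₁ refl)) (∈R₁ (inj₂ refl))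
      unused-by-F (inj₂ (refl , refl)) = edgeUses-inside≡0 F.walk F.meets-R-at-root (∈R₁ (inj₂ refl)) (∈R₁ (inj₁ refl))
    ... | no ¬j = begin
      edgeUses a b hung
        ≡⟨ edgeUses-∷-apart ¬j e (F.walk ++ back) ⟩
      edgeUses a b (F.walk ++ back)
        ≡⟨ edgeUses-++ a b F.walk back ⟩
      edgeUses a b F.walk + edgeUses a b back
        ≡⟨ cong (edgeUses a b F.walk +_) (edgeUses-bounce-apart (adj-sym e) (¬j ∘ joins-sym) β) ⟩
      edgeUses a b F.walk + 0
        ≡⟨ +-identityʳ _ ⟩
      edgeUses a b F.walk
        ≤⟨ F.uses≤4 a b ⟩
      4 ∎
      where open ≤-Reasoning

    parity-visits-y : parity (visits y hung) ≡ τ y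
    parity-visits-y = begin
      parity (visits y hung)
        ≡⟨ cong parity (visits-∷-here e (F.walk ++ back)) ⟩
      parity (suc (visits y (F.walk ++ back)))
        ≡⟨ parity-suc (visits y (F.walk ++ back)) ⟩
      1ℙ ℙ.+ parity (visits y (F.walk ++ back))
        ≡⟨ cong (λ n → 1ℙ ℙ.+ parity n) (visits-++ y F.walk back) ⟩
      1ℙ ℙ.+ parity (visits y F.walk + visits y back)
        ≡⟨ cong (1ℙ ℙ.+_) (ℙ.+-homo-+ (visits y F.walk) _) ⟩
      1ℙ ℙ.+ (parity (visits y F.walk) ℙ.+ parity (visits y back))
        ≡⟨ cong (λ p → 1ℙ ℙ.+ (parity (visits y F.walk) ℙ.+ p)) (parity-visits-bounce-start (adj-sym e) β) ⟩
      1ℙ ℙ.+ (parity (visits y F.walk) ℙ.+ β)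
        ≡⟨ cancel (parity (visits y F.walk)) (τ y) ⟩
      τ y ∎
      where
      open ≡-Reasoning
      cancel : ∀ p t → 1ℙ ℙ.+ (p ℙ.+ ((1ℙ ℙ.+ p) ℙ.+ t)) ≡ t
      cancel 0ℙ t = ℙ.⁻¹-involutive t
      cancel 1ℙ t = ℙ.⁻¹-involutive t

    visits-elsewhere : v ≢ x → v ≢ y → visits v hung ≡ visits v F.walk
    visits-elsewhere {v} v≢x v≢y = begin
      visits v hung
        ≡⟨ visits-∷-there (v≢y ∘ sym) e (F.walk ++ back) ⟩
      visits v (F.walk ++ back)
        ≡⟨ visits-++ v F.walk back ⟩
      visits v F.walk + visits v back
        ≡⟨ cong (visits v F.walk +_) (∉vertices⇒visits≡0 back ([ v≢y , v≢x ]′ ∘ ∈vertices-bounce⁻ (adj-sym e) β)) ⟩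
      visits v F.walk + 0
        ≡⟨ +-identityʳ _ ⟩
      visits v F.walk ∎
      where open ≡-Reasoning

    parity-new : v ∈ F.claimed → v ∉ R → parity (visits v hung) ≡ τ v
    parity-new {v} v∈ v∉R with v ≟ y
    ... | yes refl = parity-visits-y
    ... | no  v≢y  = trans (cong parity (visits-elsewhere (λ { refl → v∉R x∈R }) v≢y)) (F.parity-new v∈ (∉R₁ v≢y v∉R))

    even-length : parity (length hung) ≡ 0ℙ
    even-length = begin
      parity (suc (length (F.walk ++ back)))
        ≡⟨ parity-suc (length (F.walk ++ back)) ⟩
      1ℙ ℙ.+ parity (length (F.walk ++ back))
        ≡⟨ cong (λ n → 1ℙ ℙ.+ parity n) (length-++ F.walk back) ⟩
      1ℙ ℙ.+ parity (length F.walk + length back)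
        ≡⟨ cong (1ℙ ℙ.+_) (ℙ.+-homo-+ (length F.walk) (length back)) ⟩
      1ℙ ℙ.+ (parity (length F.walk) ℙ.+ parity (length back))
        ≡⟨ cong₂ (λ p q → 1ℙ ℙ.+ (p ℙ.+ q)) F.even-length (parity-length-bounce (adj-sym e) β) ⟩
      0ℙ ∎
      where open ≡-Reasoning

    closed-new : v ∈ F.claimed → v ∉ R → ∀ w → T (adj G v w) → w ∈ F.claimed
    closed-new {v} v∈ v∉R with v ≟ y
    ... | yes refl = saturated
    ... | no  v≢y  = F.closed-new v∈ (∉R₁ v≢y v∉R)

    excursion : Excursion R x
    excursion = record
      { claimed          = F.claimed
      ; R⊆claimed        = F.R⊆claimed ∘ R⊆R₁
      ; walk             = hung
      ; vertices⊆claimed = vertices⊆claimed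
      ; meets-R-at-root  = meets-R-at-root
      ; uses≤4           = uses≤4
      ; parity-new       = parity-new
      ; even-length      = even-length
      ; closed-new       = closed-new
      }

  explore : Acc _⊃_ R → x ∈ R → Σ (Excursion R x) Saturated
  explore {R} {x} (acc larger) x∈R with any? (λ y → T? (adj G x y) ×-dec ¬? (y ∈? R))
  ... | no all-neighbours-claimed =
    stay x∈R , λ w e → decidable-stable (w ∈? R) (λ w∉R → all-neighbours-claimed (w , e , w∉R))
  ... | yes (y , e , y∉R) = concat x∈R hung (proj₁ explored-x) , proj₂ explored-x
    where
    y∈R₁ : y ∈ ⁅ y ⁆ ∪ R
    y∈R₁ = x∈p∪q⁺ (inj₁ (x∈⁅x⁆ y))
    explored-y : Σ (Excursion (⁅ y ⁆ ∪ R) y) Saturated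
    explored-y = explore (larger (x∈p∪q⁺ ∘ inj₂ , y , y∈R₁ , y∉R)) y∈R₁
    open Hang e x∈R y∉R (proj₁ explored-y) (proj₂ explored-y) using (y∈claimed) renaming (excursion to hung)
    open Excursion hung using (R⊆claimed)
    explored-x : Σ (Excursion (Excursion.claimed hung) x) Saturated
    explored-x = explore (larger (R⊆claimed , y , y∈claimed , y∉R)) (R⊆claimed x∈R)

  module Along {c : Fin m} (C : Walk G c c) where

    -- The vertices on the remaining trail P are unfinished, and each of its edges keeps a budget
    -- of three traversals.
    record Progress (P : Walk G u c) : Set where
      field
        claimed       : Subset m
        walked        : Walk G c u
        C⊆claimed     : vertices C ⊆ claimed
        P⊆C           : vertices P ⊆ vertices C
        walked⊆claimed : vertices walked ⊆ claimed
        parity-done   : v ∈ claimed → v ∉ vertices P → parity (visits v walked) ≡ τ v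
        closed-done   : v ∈ claimed → v ∉ vertices P → ∀ w → T (adj G v w) → w ∈ claimed
        uses-on-C     : ∀ a b → a ∈ vertices C → b ∈ vertices C →
                        edgeUses a b walked + 3 * edgeUses a b P ≤ 3 * edgeUses a b C
        uses-off-C    : ∀ a b → a ∉ vertices C → edgeUses a b walked ≤ 4
        length-parity : parity (length walked) ℙ.+ parity (length P) ≡ parity (length C)

    SaturatedAt : {P : Walk G u c} → Progress P → Set
    SaturatedAt {u} p = ∀ w → T (adj G u w) → w ∈ Progress.claimed p

    start : Progress C
    start = record
      { claimed        = vertices C
      ; walked         = []
      ; C⊆claimed      = λ v∈ → v∈
      ; P⊆C            = λ v∈ → v∈
      ; walked⊆claimed = λ v∈ → subst (_∈ vertices C) (sym (x∈⁅y⁆⇒x≡y c v∈)) (start∈vertices C)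
      ; parity-done    = contradiction
      ; closed-done    = contradiction
      ; uses-on-C      = λ _ _ _ _ → ≤-refl
      ; uses-off-C     = λ _ _ _ → z≤n
      ; length-parity  = refl
      }

    saturate : {P : Walk G u c} → Progress P → Σ (Progress P) SaturatedAt
    saturate {u} {P} p = record
      { claimed        = F.claimed
      ; walked         = walked ++ F.walk
      ; C⊆claimed      = F.R⊆claimed ∘ C⊆claimed
      ; P⊆C            = P⊆C
      ; walked⊆claimed = vertices-++-excursion walked walked⊆claimed F
      ; parity-done    = parity-done′
      ; closed-done    = closed-done′
      ; uses-on-C      = λ a b a∈C b∈C → subst (λ n → n + 3 * edgeUses a b P ≤ 3 * edgeUses a b C)
          (sym (edgeUses-++-excursion-inside walked walked⊆claimed F (C⊆claimed a∈C) (C⊆claimed b∈C)))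
          (uses-on-C a b a∈C b∈C)
      ; uses-off-C     = λ a b a∉C → edgeUses-++-excursion≤4 walked walked⊆claimed F (uses-off-C a b a∉C)
      ; length-parity  = trans (cong (ℙ._+ parity (length P)) (parity-length-++-excursion walked walked⊆claimed F)) length-parity
      } , proj₂ explored
      where
      open Progress p
      explored = explore (⊃-wellFounded claimed) (C⊆claimed (P⊆C (start∈vertices P)))
      F = proj₁ explored
      module F = Excursion F

      parity-done′ : v ∈ F.claimed → v ∉ vertices P → parity (visits v (walked ++ F.walk)) ≡ τ v
      parity-done′ {v} v∈ v∉P with v ∈? claimed
      ... | yes v∈old = trans (cong parity (visits-++-excursion-old walked walked⊆claimed F v∈old
                                                                   λ { refl → v∉P (start∈vertices P) }))
                              (parity-done v∈old v∉P)
      ... | no  v∉old = parity-++-excursion-new walked walked⊆claimed F v∈ v∉old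

      closed-done′ : v ∈ F.claimed → v ∉ vertices P → ∀ w → T (adj G v w) → w ∈ F.claimed
      closed-done′ {v} v∈ v∉P w e with v ∈? claimed
      ... | yes v∈old = F.R⊆claimed (closed-done v∈old v∉P w e)
      ... | no  v∉old = F.closed-new v∈ v∉old w e

    module Advance (e : T (adj G u v)) (P : Walk G v c) (p : Progress (e ∷ P)) (saturated : SaturatedAt p) where
      open Progress p

      β : Parity
      β = parity (visits u walked) ℙ.+ τ u

      step : Walk G u v
      step = bounce e β

      u∈C : u ∈ vertices C
      u∈C = P⊆C (start∈vertices (e ∷ P))

      v∈C : v ∈ vertices C
      v∈C = P⊆C (vertices-tail e P (start∈vertices P))

      walked⊆claimed′ : vertices (walked ++ step) ⊆ claimed
      walked⊆claimed′ w∈ with ∈vertices-++⁻ walked step w∈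
      ... | inj₁ w∈walked = walked⊆claimed w∈walked
      ... | inj₂ w∈step   = C⊆claimed ([ (λ { refl → u∈C }) , (λ { refl → v∈C }) ]′ (∈vertices-bounce⁻ e β w∈step))

      ∉vertices-∷ : w ≢ u → w ∉ vertices P → w ∉ vertices (e ∷ P)
      ∉vertices-∷ w≢u w∉P w∈ = [ w≢u , w∉P ]′ (∈vertices-∷⁻ e P w∈)

      parity-done′ : w ∈ claimed → w ∉ vertices P → parity (visits w (walked ++ step)) ≡ τ w
      parity-done′ {w} w∈ w∉P with w ≟ u
      ... | yes refl = begin
        parity (visits u (walked ++ step))
          ≡⟨ cong parity (visits-++ u walked step) ⟩
        parity (visits u walked + visits u step)
          ≡⟨ ℙ.+-homo-+ (visits u walked) (visits u step) ⟩
        parity (visits u walked) ℙ.+ parity (visits u step)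
          ≡⟨ cong (parity (visits u walked) ℙ.+_) (parity-visits-bounce-start e β) ⟩
        parity (visits u walked) ℙ.+ β
          ≡⟨ cancel (parity (visits u walked)) (τ u) ⟩
        τ u ∎
        where
        open ≡-Reasoning
        cancel : ∀ p t → p ℙ.+ (p ℙ.+ t) ≡ t
        cancel 0ℙ t = refl
        cancel 1ℙ t = ℙ.⁻¹-involutive t
      ... | no  w≢u = begin
        parity (visits w (walked ++ step))
          ≡⟨ cong parity (visits-++ w walked step) ⟩
        parity (visits w walked + visits w step)
          ≡⟨ cong (λ n → parity (visits w walked + n)) (∉vertices⇒visits≡0 step w∉step) ⟩
        parity (visits w walked + 0)
          ≡⟨ cong parity (+-identityʳ (visits w walked)) ⟩
        parity (visits w walked)
          ≡⟨ parity-done w∈ (∉vertices-∷ w≢u w∉P) ⟩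
        τ w ∎
        where
        open ≡-Reasoning
        w∉step : w ∉ vertices step
        w∉step w∈ = [ w≢u , (λ { refl → w∉P (start∈vertices P) }) ]′ (∈vertices-bounce⁻ e β w∈)

      closed-done′ : w ∈ claimed → w ∉ vertices P → ∀ x → T (adj G w x) → x ∈ claimed
      closed-done′ {w} w∈ w∉P with w ≟ u
      ... | yes refl = saturated
      ... | no  w≢u  = closed-done w∈ (∉vertices-∷ w≢u w∉P)

      uses-on-C′ : ∀ a b → a ∈ vertices C → b ∈ vertices C →
        edgeUses a b (walked ++ step) + 3 * edgeUses a b P ≤ 3 * edgeUses a b C
      uses-on-C′ a b a∈C b∈C = begin
        edgeUses a b (walked ++ step) + 3 * edgeUses a b P
          ≡⟨ cong (_+ 3 * edgeUses a b P) (edgeUses-++ a b walked step) ⟩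
        edgeUses a b walked + edgeUses a b step + 3 * edgeUses a b P
          ≤⟨ step≤ (joins? a b u v) ⟩
        edgeUses a b walked + 3 * edgeUses a b (e ∷ P)
          ≤⟨ uses-on-C a b a∈C b∈C ⟩
        3 * edgeUses a b C ∎
        where
        open ≤-Reasoning
        step≤ : Dec (Joins a b u v) → edgeUses a b walked + edgeUses a b step + 3 * edgeUses a b P
                                      ≤ edgeUses a b walked + 3 * edgeUses a b (e ∷ P)
        step≤ (yes j) rewrite edgeUses-∷-joins j e P =
          spend-three (edgeUses a b walked) (edgeUses a b P) (edgeUses-bounce≤3 e a b β)
        step≤ (no ¬j) rewrite edgeUses-∷-apart ¬j e P | edgeUses-bounce-apart e ¬j β
                            | +-identityʳ (edgeUses a b walked) = ≤-refl

      uses-off-C′ : ∀ a b → a ∉ vertices C → edgeUses a b (walked ++ step) ≤ 4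
      uses-off-C′ a b a∉C = begin
        edgeUses a b (walked ++ step)
          ≡⟨ edgeUses-++ a b walked step ⟩
        edgeUses a b walked + edgeUses a b step
          ≡⟨ cong (edgeUses a b walked +_) (∉vertices⇒edgeUses≡0 step a∉step) ⟩
        edgeUses a b walked + 0
          ≡⟨ +-identityʳ _ ⟩
        edgeUses a b walked
          ≤⟨ uses-off-C a b a∉C ⟩
        4 ∎
        where
        open ≤-Reasoning
        a∉step : a ∉ vertices step
        a∉step a∈ = [ (λ { refl → a∉C u∈C }) , (λ { refl → a∉C v∈C }) ]′ (∈vertices-bounce⁻ e β a∈)

      length-parity′ : parity (length (walked ++ step)) ℙ.+ parity (length P) ≡ parity (length C)
      length-parity′ = begin
        parity (length (walked ++ step)) ℙ.+ parity (length P)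
          ≡⟨ cong (λ n → parity n ℙ.+ parity (length P)) (length-++ walked step) ⟩
        parity (length walked + length step) ℙ.+ parity (length P)
          ≡⟨ cong (ℙ._+ parity (length P)) (ℙ.+-homo-+ (length walked) (length step)) ⟩
        parity (length walked) ℙ.+ parity (length step) ℙ.+ parity (length P)
          ≡⟨ cong (λ q → parity (length walked) ℙ.+ q ℙ.+ parity (length P)) (parity-length-bounce e β) ⟩
        parity (length walked) ℙ.+ 1ℙ ℙ.+ parity (length P)
          ≡⟨ ℙ.+-assoc (parity (length walked)) 1ℙ (parity (length P)) ⟩
        parity (length walked) ℙ.+ (1ℙ ℙ.+ parity (length P))
          ≡⟨ cong (parity (length walked) ℙ.+_) (sym (parity-suc (length P))) ⟩
        parity (length walked) ℙ.+ parity (length (e ∷ P))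
          ≡⟨ length-parity ⟩
        parity (length C) ∎
        where open ≡-Reasoning

      progress : Progress P
      progress = record
        { claimed        = claimed
        ; walked         = walked ++ step
        ; C⊆claimed      = C⊆claimed
        ; P⊆C            = P⊆C ∘ vertices-tail e P
        ; walked⊆claimed = walked⊆claimed′
        ; parity-done    = parity-done′
        ; closed-done    = closed-done′
        ; uses-on-C      = uses-on-C′
        ; uses-off-C     = uses-off-C′
        ; length-parity  = length-parity′
        }

    run : (P : Walk G u c) → Progress P → Σ (Progress []) SaturatedAt
    run []      p = saturate p
    run (e ∷ P) p = run P (uncurry (Advance.progress e P) (saturate p))

    conclude : Connected G → Trail C → sum τ ≡ parity (length C) →
      (p : Progress []) → SaturatedAt p → TargetWalk c
    conclude conn C-trail ∑τ p saturated = walked , parities , uses≤4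
      where
      open Progress p

      closed : v ∈ claimed → ∀ w → T (adj G v w) → w ∈ claimed
      closed {v} v∈ with v ≟ c
      ... | yes refl = saturated
      ... | no  v≢c  = closed-done v∈ (v≢c ∘ x∈⁅y⁆⇒x≡y c)

      done : v ≢ c → parity (visits v walked) ≡ τ v
      done v≢c = parity-done (closed⇒everything conn (C⊆claimed (start∈vertices C)) closed _) (v≢c ∘ x∈⁅y⁆⇒x≡y c)

      parities : ∀ x → parity (visits x walked) ≡ τ x
      parities x with x ≟ c
      ... | no  x≢c  = done x≢c
      ... | yes refl = sum-determines-value (λ x → parity (visits x walked)) τ c (begin
        sum (λ x → parity (visits x walked))  ≡⟨ sym (parity-length walked) ⟩
        parity (length walked)                ≡⟨ sym (ℙ.+-identityʳ _) ⟩
        parity (length walked) ℙ.+ 0ℙ         ≡⟨ length-parity ⟩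
        parity (length C)                     ≡⟨ sym ∑τ ⟩
        sum τ                                 ∎) (λ x x≢c → done x≢c)
        where open ≡-Reasoning

      uses≤4 : ∀ a b → edgeUses a b walked ≤ 4
      uses≤4 a b with a ∈? vertices C | b ∈? vertices C
      ... | no  a∉C | _       = uses-off-C a b a∉C
      ... | yes _   | no  b∉C = subst (_≤ 4) (edgeUses-comm b a walked) (uses-off-C b a b∉C)
      ... | yes a∈C | yes b∈C = begin
        edgeUses a b walked            ≤⟨ m≤m+n _ 0 ⟩
        edgeUses a b walked + 3 * 0    ≤⟨ uses-on-C a b a∈C b∈C ⟩
        3 * edgeUses a b C             ≤⟨ *-monoʳ-≤ 3 (C-trail a b) ⟩
        3                              ≤⟨ n≤1+n 3 ⟩
        4                              ∎
        where open ≤-Reasoning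

    walkAlong : Connected G → Trail C → sum τ ≡ parity (length C) → TargetWalk c
    walkAlong conn C-trail ∑τ = uncurry (conclude conn C-trail ∑τ) (run C start)

theorem3p5 : ∀ {n : ℕ} (G : Graph (suc n)) → Connected G → (S : Subset (suc n)) →
    (HasSOddWalk G S ⇔ (Even ∣ S ∣ ⊎ ¬ Bipartite G))
    × (HasSOddWalk G S →
        Σ[ v ∈ Fin (suc n) ] Σ[ W ∈ Walk G v v ]
          (IsSOdd G S W × (∀ (a b : Fin (suc n)) → T (adj G a b) → edgeUses a b W ≤ 4)))
theorem3p5 {n} G conn S =
  mk⇔ sOddWalk⇒even∨nonBipartite (forget-bound ∘ construct) , construct ∘ sOddWalk⇒even∨nonBipartite
  where
  open Construction G (χ S) using (module Along)

  backbone : Even ∣ S ∣ ⊎ ¬ Bipartite G → ClosedTrail (parity ∣ S ∣)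
  backbone (inj₁ even) = zero , [] , (λ _ _ → z≤n) , sym (parity-even even)
  backbone (inj₂ ¬bipartite) with parity ∣ S ∣
  ... | 0ℙ = zero , [] , (λ _ _ → z≤n) , refl
  ... | 1ℙ = oddClosedTrail conn ¬bipartite zero

  BoundedSOddWalk : Set
  BoundedSOddWalk = Σ[ v ∈ Fin (suc n) ] Σ[ W ∈ Walk G v v ] (IsSOdd G S W × (∀ a b → T (adj G a b) → edgeUses a b W ≤ 4))

  construct : Even ∣ S ∣ ⊎ ¬ Bipartite G → BoundedSOddWalk
  construct h with c , C , C-trail , C-parity ← backbone h
    with W , parities , uses≤4 ← Along.walkAlong C conn C-trail (trans (sym (parity-size S)) (sym C-parity))
    = c , W , parity⇒isSOdd W parities , λ a b _ → uses≤4 a b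

  forget-bound : BoundedSOddWalk → HasSOddWalk G S
  forget-bound (v , W , odd , _) = v , W , odd
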